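{- Let $f:\mathbb{Z}_{>0}\to\mathbb{C}$ be a multiplicative function such that $f(a_1^2+a_2^2+a_3^2+a_4^2+a_5^2)=f(a_1^2)+f(a_2^2)+f(a_3^2)+f(a_4^2)+f(a_5^2)$ for all positive integers $a_1,\dots,a_5$. Then $f(n)=n$ for $1\le n\le 16$.
   Context: A function $f$ on the positive integers is multiplicative if $f(1)=1$ and $f(mn)=f(m)f(n)$ whenever $\gcd(m,n)=1$. -}

module Defs where

open import Level using (_⊔_)
open import Algebra.Bundles using (CommutativeRing)
open import Data.Nat using (ℕ; zero; suc; NonZero) renaming (_*_ to _*ℕ_; _+_ to _+ℕ_; _^_ to _^ℕ_)
open import Data.Nat.Coprimality using (Coprime)
open import Data.Product using (∃)
open import Relation.Nullary using (¬_)

-- Stand-in for ℂ (no complex numbers in agda-stdlib): an arbitrary field of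
-- characteristic zero, given as a commutative ring with 1 ≠ 0, inverses of
-- nonzero elements, and n·1 ≠ 0 for all n ≥ 1.
module _ {c ℓ} (R : CommutativeRing c ℓ) where
  open CommutativeRing R

  ι : ℕ → Carrier
  ι zero    = 0#
  ι (suc n) = 1# + ι n

  IsField : Set (c ⊔ ℓ)
  IsField = (¬ (1# ≈ 0#)) × ((x : Carrier) → ¬ (x ≈ 0#) → ∃ λ y → (x * y) ≈ 1#)
    where open import Data.Product using (_×_)

  CharZero : Set ℓ
  CharZero = (n : ℕ) → ¬ (ι (suc n) ≈ 0#)

  -- f is a function on the positive integers (its value at 0 is irrelevant
  -- and never constrained); multiplicative as in the paper.
  Multiplicative : (ℕ → Carrier) → Set ℓ
  Multiplicative f =
    (f 1 ≈ 1#) ×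
    ((m n : ℕ) → NonZero m → NonZero n → Coprime m n → f (m *ℕ n) ≈ (f m * f n))
    where open import Data.Product using (_×_)

  FiveSquares : (ℕ → Carrier) → Set ℓ
  FiveSquares f =
    (a₁ a₂ a₃ a₄ a₅ : ℕ) → NonZero a₁ → NonZero a₂ → NonZero a₃ → NonZero a₄ → NonZero a₅ →
    f (a₁ ^ℕ 2 +ℕ a₂ ^ℕ 2 +ℕ a₃ ^ℕ 2 +ℕ a₄ ^ℕ 2 +ℕ a₅ ^ℕ 2)
      ≈ (f (a₁ ^ℕ 2) + f (a₂ ^ℕ 2) + f (a₃ ^ℕ 2) + f (a₄ ^ℕ 2) + f (a₅ ^ℕ 2))

-- Put δ(n) = f(n) − n. Since n ↦ n itself satisfies the five-squares relation and is
-- multiplicative, δ satisfies the same additive relation, and δ(mn) = m δ(n) whenever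
-- f(m) = m and gcd(m,n) = 1. From δ(1) = 0, the representations 5 = 5·1², 16 = 3²+2²+3·1²,
-- 20 = 4²+4·1² and 35 = 2·4²+3·1² = 3·3²+2·2² give δ(9) = 0 and 5 δ(4) = δ(20) = δ(16) = δ(4),
-- so δ(4) = 0 in characteristic zero; then 35, 14 = 3·2²+2·1² and 21 = 2·3²+3·1² give
-- δ(7) = δ(2) = δ(3) = 0, and every other n ≤ 16 is a product of coprime known values or a
-- sum of five known squares.
module Submission where

open import Algebra.Bundles using (CommutativeRing)
open import Data.List using (applyUpTo)
open import Data.List.Membership.Propositional.Properties using (∈-applyUpTo⁺)
open import Data.List.Relation.Unary.All as All using (All; []; _∷_)
open import Data.Nat as ℕ using (ℕ; zero; suc; _^_; _≤_; NonZero)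
open import Data.Nat.Coprimality using (Coprime; gcd≡1⇒coprime)
open import Data.Product using (_,_; proj₁; proj₂)
import Relation.Binary.PropositionalEquality as ≡
open import Relation.Nullary using (¬_)

open import Defs

module _ {c ℓ} (R : CommutativeRing c ℓ) where
  open CommutativeRing R
  open import Algebra.Properties.Semiring.Mult semiring using (_×_; ×-homo-+; ×1-homo-*)
  open import Algebra.Properties.Ring ring using (x[y-z]≈xy-xz)
  open import Algebra.Properties.AbelianGroup +-abelianGroup using (⁻¹-∙-comm)
  open import Algebra.Properties.CommutativeSemigroup +-commutativeSemigroup using (interchange)
  open import Relation.Binary.Reasoning.Setoid setoid

  ι≈×1# : ∀ n → ι R n ≈ n × 1#
  ι≈×1# zero    = refl
  ι≈×1# (suc n) = +-congˡ (ι≈×1# n)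

  ι-homo-+ : ∀ m n → ι R (m ℕ.+ n) ≈ ι R m + ι R n
  ι-homo-+ m n = begin
    ι R (m ℕ.+ n)    ≈⟨ ι≈×1# (m ℕ.+ n) ⟩
    (m ℕ.+ n) × 1#   ≈⟨ ×-homo-+ 1# m n ⟩
    m × 1# + n × 1#  ≈⟨ +-cong (ι≈×1# m) (ι≈×1# n) ⟨
    ι R m + ι R n    ∎

  ι-homo-* : ∀ m n → ι R (m ℕ.* n) ≈ ι R m * ι R n
  ι-homo-* m n = begin
    ι R (m ℕ.* n)        ≈⟨ ι≈×1# (m ℕ.* n) ⟩
    (m ℕ.* n) × 1#       ≈⟨ ×1-homo-* m n ⟩
    (m × 1#) * (n × 1#)  ≈⟨ *-cong (ι≈×1# m) (ι≈×1# n) ⟨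
    ι R m * ι R n        ∎

  ι-suc-* : ∀ n x → ι R (suc n) * x ≈ x + ι R n * x
  ι-suc-* n x = trans (distribʳ x 1# (ι R n)) (+-congʳ (*-identityˡ x))

  ι-homo-+₅ : ∀ a b c d e →
    ι R (a ℕ.+ b ℕ.+ c ℕ.+ d ℕ.+ e) ≈ ι R a + ι R b + ι R c + ι R d + ι R e
  ι-homo-+₅ a b c d e =
    trans (ι-homo-+ (a ℕ.+ b ℕ.+ c ℕ.+ d) e) (+-congʳ
    (trans (ι-homo-+ (a ℕ.+ b ℕ.+ c) d) (+-congʳ
    (trans (ι-homo-+ (a ℕ.+ b) c) (+-congʳ (ι-homo-+ a b))))))

  +-−-interchange : ∀ x u y v → (x + u) - (y + v) ≈ (x - y) + (u - v)
  +-−-interchange x u y v = begin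
    (x + u) + - (y + v)      ≈⟨ +-congˡ (⁻¹-∙-comm y v) ⟨
    (x + u) + (- y + - v)    ≈⟨ interchange x u (- y) (- v) ⟩
    (x + - y) + (u + - v)    ∎

  +-−-interchange₅ : ∀ x₁ x₂ x₃ x₄ x₅ y₁ y₂ y₃ y₄ y₅ →
    (x₁ + x₂ + x₃ + x₄ + x₅) - (y₁ + y₂ + y₃ + y₄ + y₅)
      ≈ (x₁ - y₁) + (x₂ - y₂) + (x₃ - y₃) + (x₄ - y₄) + (x₅ - y₅)
  +-−-interchange₅ x₁ x₂ x₃ x₄ x₅ y₁ y₂ y₃ y₄ y₅ =
    trans (+-−-interchange (x₁ + x₂ + x₃ + x₄) x₅ (y₁ + y₂ + y₃ + y₄) y₅) (+-congʳ
    (trans (+-−-interchange (x₁ + x₂ + x₃) x₄ (y₁ + y₂ + y₃) y₄) (+-congʳ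
    (trans (+-−-interchange (x₁ + x₂) x₃ (y₁ + y₂) y₃) (+-congʳ
    (+-−-interchange x₁ x₂ y₁ y₂))))))

  nonzero-*-cancel : IsField R → ∀ {a x} → ¬ a ≈ 0# → a * x ≈ 0# → x ≈ 0#
  nonzero-*-cancel (_ , inverse) {a} {x} a≉0 ax≈0 =
    let b , ab≈1 = inverse a a≉0 in begin
    x            ≈⟨ *-identityˡ x ⟨
    1# * x       ≈⟨ *-congʳ ab≈1 ⟨
    (a * b) * x  ≈⟨ *-congʳ (*-comm a b) ⟩
    (b * a) * x  ≈⟨ *-assoc b a x ⟩
    b * (a * x)  ≈⟨ *-congˡ ax≈0 ⟩
    b * 0#       ≈⟨ zeroʳ b ⟩
    0#           ∎

  ι-suc-*-cancel : IsField R → CharZero R → ∀ n {x} → ι R (suc n) * x ≈ 0# → x ≈ 0#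
  ι-suc-*-cancel isField charZero n = nonzero-*-cancel isField (charZero n)

  module _ (f : ℕ → Carrier) where
    open import Algebra.Properties.Group +-group
      using (x∙y⁻¹≈ε⇒x≈y; identityˡ-unique; identityʳ-unique)

    δ : ℕ → Carrier
    δ n = f n - ι R n

    δ≈0⇒f≈ι : ∀ {n} → δ n ≈ 0# → f n ≈ ι R n
    δ≈0⇒f≈ι = x∙y⁻¹≈ε⇒x≈y _ _

    -- Left-nested like the sums in FiveSquares, so that δ-fiveSquares a b 1 1 1 ends in
    -- δ (a ^ 2) + δ (b ^ 2) +δ₁× 3 by definition.
    _+δ₁×_ : Carrier → ℕ → Carrier
    x +δ₁× zero  = x
    x +δ₁× suc k = x +δ₁× k + δ 1

    module MultiplicativeDefect (mult : Multiplicative R f) where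

      δ₁ : δ 1 ≈ 0#
      δ₁ = trans (+-cong (proj₁ mult) (-‿cong (+-identityʳ 1#))) (-‿inverseʳ 1#)

      +δ₁×-identity : ∀ k x → x +δ₁× k ≈ x
      +δ₁×-identity zero    x = refl
      +δ₁×-identity (suc k) x = trans (+-cong (+δ₁×-identity k x) δ₁) (+-identityʳ x)

      δ-* : ∀ m n → {{NonZero m}} → {{NonZero n}} → Coprime m n →
            δ m ≈ 0# → δ (m ℕ.* n) ≈ ι R m * δ n
      δ-* m n {{m≢0}} {{n≢0}} m⊥n δm≈0 = begin
        f (m ℕ.* n) - ι R (m ℕ.* n)    ≈⟨ +-cong (proj₂ mult m n m≢0 n≢0 m⊥n) (-‿cong (ι-homo-* m n)) ⟩
        f m * f n - ι R m * ι R n      ≈⟨ +-congʳ (*-congʳ (δ≈0⇒f≈ι δm≈0)) ⟩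
        ι R m * f n - ι R m * ι R n    ≈⟨ x[y-z]≈xy-xz (ι R m) (f n) (ι R n) ⟨
        ι R m * δ n                    ∎

      δ-*-≈0 : ∀ m n → {{NonZero m}} → {{NonZero n}} → Coprime m n →
               δ m ≈ 0# → δ n ≈ 0# → δ (m ℕ.* n) ≈ 0#
      δ-*-≈0 m n m⊥n δm≈0 δn≈0 =
        trans (δ-* m n m⊥n δm≈0) (trans (*-congˡ δn≈0) (zeroʳ (ι R m)))

    module FiveSquaresDefect (fiveSquares : FiveSquares R f) where

      δ-fiveSquares : ∀ a b c d e → {{NonZero a}} → {{NonZero b}} →
        {{NonZero c}} → {{NonZero d}} → {{NonZero e}} →
        δ (a ^ 2 ℕ.+ b ^ 2 ℕ.+ c ^ 2 ℕ.+ d ^ 2 ℕ.+ e ^ 2)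
          ≈ δ (a ^ 2) + δ (b ^ 2) + δ (c ^ 2) + δ (d ^ 2) + δ (e ^ 2)
      δ-fiveSquares a b c d e {{a≢0}} {{b≢0}} {{c≢0}} {{d≢0}} {{e≢0}} =
        trans (+-cong (fiveSquares a b c d e a≢0 b≢0 c≢0 d≢0 e≢0)
                      (-‿cong (ι-homo-+₅ (a ^ 2) (b ^ 2) (c ^ 2) (d ^ 2) (e ^ 2))))
              (+-−-interchange₅ _ _ _ _ _ _ _ _ _ _)

    module _ (isField : IsField R) (charZero : CharZero R)
             (mult : Multiplicative R f) (fiveSquares : FiveSquares R f) where
      open MultiplicativeDefect mult
      open FiveSquaresDefect fiveSquares
      open import Algebra.Solver.CommutativeMonoid +-commutativeMonoid using (solve; _⊕_; _⊜_)

      private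
        infixl 6 _+₀_
        _+₀_ : ∀ {x y} → x ≈ 0# → y ≈ 0# → x + y ≈ 0#
        x≈0 +₀ y≈0 = trans (+-cong x≈0 y≈0) (+-identityʳ 0#)

        cancel : ∀ n {x} → ι R (suc n) * x ≈ 0# → x ≈ 0#
        cancel = ι-suc-*-cancel isField charZero

      δ₅ : δ 5 ≈ 0#
      δ₅ = trans (δ-fiveSquares 1 1 1 1 1) (trans (+δ₁×-identity 4 (δ 1)) δ₁)

      δ₁₆≈δ₉+δ₄ : δ 16 ≈ δ 9 + δ 4
      δ₁₆≈δ₉+δ₄ = trans (δ-fiveSquares 3 2 1 1 1) (+δ₁×-identity 3 _)

      δ₃₅≈δ₁₆+δ₁₆ : δ 35 ≈ δ 16 + δ 16
      δ₃₅≈δ₁₆+δ₁₆ = trans (δ-fiveSquares 4 4 1 1 1) (+δ₁×-identity 3 _)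

      δ₉ : δ 9 ≈ 0#
      δ₉ = identityˡ-unique (δ 9) ((δ 9 + δ 4) + (δ 9 + δ 4)) (begin
        δ 9 + ((δ 9 + δ 4) + (δ 9 + δ 4))  ≈⟨ rearrange (δ 9) (δ 4) ⟩
        δ 9 + δ 9 + δ 9 + δ 4 + δ 4        ≈⟨ δ-fiveSquares 3 3 3 2 2 ⟨
        δ 35                               ≈⟨ δ₃₅≈δ₁₆+δ₁₆ ⟩
        δ 16 + δ 16                        ≈⟨ +-cong δ₁₆≈δ₉+δ₄ δ₁₆≈δ₉+δ₄ ⟩
        (δ 9 + δ 4) + (δ 9 + δ 4)          ∎)
        where
        rearrange : ∀ x y → x + ((x + y) + (x + y)) ≈ x + x + x + y + y
        rearrange = solve 2 (λ x y → x ⊕ ((x ⊕ y) ⊕ (x ⊕ y)) ⊜ (((x ⊕ x) ⊕ x) ⊕ y) ⊕ y) refl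

      δ₁₆≈δ₄ : δ 16 ≈ δ 4
      δ₁₆≈δ₄ = trans δ₁₆≈δ₉+δ₄ (trans (+-congʳ δ₉) (+-identityˡ (δ 4)))

      δ₄ : δ 4 ≈ 0#
      δ₄ = cancel 3 (identityʳ-unique (δ 4) (ι R 4 * δ 4) (begin
        δ 4 + ι R 4 * δ 4  ≈⟨ ι-suc-* 4 (δ 4) ⟨
        ι R 5 * δ 4        ≈⟨ δ-* 5 4 (gcd≡1⇒coprime ≡.refl) δ₅ ⟨
        δ 20               ≈⟨ trans (δ-fiveSquares 4 1 1 1 1) (+δ₁×-identity 4 _) ⟩
        δ 16               ≈⟨ δ₁₆≈δ₄ ⟩
        δ 4                ∎))

      δ₁₆ : δ 16 ≈ 0#
      δ₁₆ = trans δ₁₆≈δ₄ δ₄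

      δ₇ : δ 7 ≈ 0#
      δ₇ = cancel 4 (begin
        ι R 5 * δ 7  ≈⟨ δ-* 5 7 (gcd≡1⇒coprime ≡.refl) δ₅ ⟨
        δ 35         ≈⟨ δ₃₅≈δ₁₆+δ₁₆ ⟩
        δ 16 + δ 16  ≈⟨ δ₁₆ +₀ δ₁₆ ⟩
        0#           ∎)

      δ₂ : δ 2 ≈ 0#
      δ₂ = cancel 6 (begin
        ι R 7 * δ 2        ≈⟨ δ-* 7 2 (gcd≡1⇒coprime ≡.refl) δ₇ ⟨
        δ 14               ≈⟨ trans (δ-fiveSquares 2 2 2 1 1) (+δ₁×-identity 2 _) ⟩
        δ 4 + δ 4 + δ 4    ≈⟨ δ₄ +₀ δ₄ +₀ δ₄ ⟩
        0#                 ∎)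

      δ₃ : δ 3 ≈ 0#
      δ₃ = cancel 6 (begin
        ι R 7 * δ 3  ≈⟨ δ-* 7 3 (gcd≡1⇒coprime ≡.refl) δ₇ ⟨
        δ 21         ≈⟨ trans (δ-fiveSquares 3 3 1 1 1) (+δ₁×-identity 3 _) ⟩
        δ 9 + δ 9    ≈⟨ δ₉ +₀ δ₉ ⟩
        0#           ∎)

      δ-vanishes : All (λ n → δ n ≈ 0#) (applyUpTo suc 16)
      δ-vanishes =
        δ₁ ∷ δ₂ ∷ δ₃ ∷ δ₄ ∷ δ₅ ∷
        δ-*-≈0 2 3 (gcd≡1⇒coprime ≡.refl) δ₂ δ₃ ∷
        δ₇ ∷
        trans (δ-fiveSquares 2 1 1 1 1) (trans (+δ₁×-identity 4 _) δ₄) ∷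
        δ₉ ∷
        δ-*-≈0 2 5 (gcd≡1⇒coprime ≡.refl) δ₂ δ₅ ∷
        trans (δ-fiveSquares 2 2 1 1 1) (trans (+δ₁×-identity 3 _) (δ₄ +₀ δ₄)) ∷
        δ-*-≈0 3 4 (gcd≡1⇒coprime ≡.refl) δ₃ δ₄ ∷
        trans (δ-fiveSquares 3 1 1 1 1) (trans (+δ₁×-identity 4 _) δ₉) ∷
        δ-*-≈0 2 7 (gcd≡1⇒coprime ≡.refl) δ₂ δ₇ ∷
        δ-*-≈0 3 5 (gcd≡1⇒coprime ≡.refl) δ₃ δ₅ ∷
        δ₁₆ ∷ []

mainTheorem5 : ∀ {c ℓ} (R : CommutativeRing c ℓ) → IsField R → CharZero R →
    (f : ℕ → CommutativeRing.Carrier R) → Multiplicative R f → FiveSquares R f →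
    (n : ℕ) → 1 ≤ n → n ≤ 16 → CommutativeRing._≈_ R (f n) (ι R n)
mainTheorem5 R isField charZero f mult fiveSquares (suc m) _ m<16 =
  δ≈0⇒f≈ι R f (All.lookup (δ-vanishes R f isField charZero mult fiveSquares)
                          (∈-applyUpTo⁺ suc m<16))
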